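{- The reduction relation $\rightarrow_{\beta\pi\sigma\mu\epsilon}$ of $\lambda\mathbf{J}^{\mathbf{mse}}$ is confluent (on all, not necessarily typable, terms): if $t\rightarrow^* t_1$ and $t\rightarrow^* t_2$, then there is $t_3$ with $t_1\rightarrow^* t_3$ and $t_2\rightarrow^* t_3$.
   Context: The calculus $\lambda\mathbf{J}^{\mathbf{mse}}$: terms $t,u,v::= x\mid \lambda x.t\mid \{c\}$; co-terms $l::= []\mid u::l\mid (x)c$; commands $c::= t\,l$. $\lambda x$ binds $x$ in $t$, $(x)$ binds $x$ in $c$; $[t/x]T$ is capture-avoiding substitution. Evaluation contexts $E::=[]\mid u::l$. Append: $[]@l'=l'$, $(u::l)@l'=u::(l@l')$, $((x)\,t\,l)@l'=(x)\,t\,(l@l')$. The reduction $\rightarrow$ is the closure under all constructors of: $(\beta)\ (\lambda x.t)(u::l)\rightarrow u\,((x)\,t\,l)$; $(\pi)\ \{t\,l\}\,E\rightarrow t\,(l@E)$; $(\sigma)\ t\,(x)c\rightarrow [t/x]c$; $(\mu)\ (x)\,x\,l\rightarrow l$ if $x$ not free in $l$; $(\epsilon)\ \{t\,[]\}\rightarrow t$. -}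

module Defs where

-- Syntax of λJ^mse with intrinsically well-scoped de Bruijn indices:
-- an expression of sort X n has its free variables among Fin n.
-- Binders λx and (x) are represented by going from scope n to scope suc n,
-- so alpha-equivalence is syntactic equality and substitution is
-- automatically capture-avoiding.

open import Data.Nat using (ℕ; zero; suc)
open import Data.Fin using (Fin; zero; suc)
open import Relation.Binary.Construct.Closure.ReflexiveTransitive using (Star)

mutual
  -- terms  t ::= x | λx.t | {c}
  data Term (n : ℕ) : Set where
    var : Fin n → Term n
    lam : Term (suc n) → Term n
    brc : Cmd n → Term n

  -- co-terms  l ::= [] | u :: l | (x)c
  data CoTerm (n : ℕ) : Set where
    nil  : CoTerm n
    cons : Term n → CoTerm n → CoTerm n
    abs  : Cmd (suc n) → CoTerm n

  -- commands  c ::= t l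
  data Cmd (n : ℕ) : Set where
    cut : Term n → CoTerm n → Cmd n

Ren : ℕ → ℕ → Set
Ren n m = Fin n → Fin m

liftR : ∀ {n m} → Ren n m → Ren (suc n) (suc m)
liftR ρ zero    = zero
liftR ρ (suc i) = suc (ρ i)

mutual
  renT : ∀ {n m} → Ren n m → Term n → Term m
  renT ρ (var i) = var (ρ i)
  renT ρ (lam t) = lam (renT (liftR ρ) t)
  renT ρ (brc c) = brc (renC ρ c)

  renL : ∀ {n m} → Ren n m → CoTerm n → CoTerm m
  renL ρ nil        = nil
  renL ρ (cons u l) = cons (renT ρ u) (renL ρ l)
  renL ρ (abs c)    = abs (renC (liftR ρ) c)

  renC : ∀ {n m} → Ren n m → Cmd n → Cmd m
  renC ρ (cut t l) = cut (renT ρ t) (renL ρ l)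

wkL : ∀ {n} → CoTerm n → CoTerm (suc n)
wkL = renL suc

Sub : ℕ → ℕ → Set
Sub n m = Fin n → Term m

liftS : ∀ {n m} → Sub n m → Sub (suc n) (suc m)
liftS σ zero    = var zero
liftS σ (suc i) = renT suc (σ i)

mutual
  subT : ∀ {n m} → Sub n m → Term n → Term m
  subT σ (var i) = σ i
  subT σ (lam t) = lam (subT (liftS σ) t)
  subT σ (brc c) = brc (subC σ c)

  subL : ∀ {n m} → Sub n m → CoTerm n → CoTerm m
  subL σ nil        = nil
  subL σ (cons u l) = cons (subT σ u) (subL σ l)
  subL σ (abs c)    = abs (subC (liftS σ) c)

  subC : ∀ {n m} → Sub n m → Cmd n → Cmd m
  subC σ (cut t l) = cut (subT σ t) (subL σ l)

sub0 : ∀ {n} → Term n → Sub (suc n) n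
sub0 t zero    = t
sub0 t (suc i) = var i

_[_]C : ∀ {n} → Cmd (suc n) → Term n → Cmd n
c [ t ]C = subC (sub0 t) c

_++L_ : ∀ {n} → CoTerm n → CoTerm n → CoTerm n
nil        ++L l' = l'
cons u l   ++L l' = cons u (l ++L l')
abs (cut t l) ++L l' = abs (cut t (l ++L wkL l'))

data IsEvalCtx {n : ℕ} : CoTerm n → Set where
  ec-nil  : IsEvalCtx nil
  ec-cons : ∀ u l → IsEvalCtx (cons u l)

mutual
  data _→T_ {n : ℕ} : Term n → Term n → Set where
    ε    : ∀ t → brc (cut t nil) →T t
    lamξ : ∀ {t t'} → t →T t' → lam t →T lam t'
    brcξ : ∀ {c c'} → c →C c' → brc c →T brc c'

  data _→L_ {n : ℕ} : CoTerm n → CoTerm n → Set where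
    -- (μ)  (x) x l → l   if x not free in l
    μ     : ∀ l → abs (cut (var zero) (wkL l)) →L l
    consξ₁ : ∀ {u u' l} → u →T u' → cons u l →L cons u' l
    consξ₂ : ∀ {u l l'} → l →L l' → cons u l →L cons u l'
    absξ  : ∀ {c c'} → c →C c' → abs c →L abs c'

  data _→C_ {n : ℕ} : Cmd n → Cmd n → Set where
    -- (β)  (λx.t)(u::l) → u ((x) t l)      (x not free in l)
    β    : ∀ t u l → cut (lam t) (cons u l) →C cut u (abs (cut t (wkL l)))
    π    : ∀ t l E → IsEvalCtx E → cut (brc (cut t l)) E →C cut t (l ++L E)
    σ    : ∀ t c → cut t (abs c) →C (c [ t ]C)
    cutξ₁ : ∀ {t t' l} → t →T t' → cut t l →C cut t' l
    cutξ₂ : ∀ {t l l'} → l →L l' → cut t l →C cut t l'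

_→*T_ : ∀ {n} → Term n → Term n → Set
_→*T_ = Star _→T_

-- Split → into the parallel βσ-reduction ⇒ and the administrative πμε-reduction ↝; one →-step
-- is a ⇒- or a ↝-step, and both are contained in →*.  ⇒ has the triangle property with respect
-- to complete development, so it is confluent.  ↝ strictly decreases size and is locally
-- confluent (the π/π overlap closes by associativity of append), hence confluent by Newman's
-- lemma.  A ⇒-step and a ↝-step are closed by one ⇒-step and some ↝-steps (in the μ/σ overlap
-- both rules yield the same command), so ⇒ and ↝ commute, and Hindley–Rosen gives confluence
-- of their union.

module Submission where

open import Defs
open import Level using (Level)
open import Data.Nat using (ℕ; zero; suc; _+_; _<_; s≤s)
open import Data.Nat.Properties using (+-assoc; m≤m+n; n≤1+n; n<1+n; <-trans; +-monoˡ-<; +-monoʳ-<)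
open import Data.Nat.Induction using (<-wellFounded)
open import Data.Fin using (Fin; zero; suc)
open import Data.Fin.Properties using (suc-injective)
open import Data.Product using (Σ; ∃; ∃₂; _×_; _,_; -,_; map₂; swap)
open import Data.Sum using (_⊎_; inj₁; inj₂; [_,_]) renaming (map to ⊎-map)
open import Function using (_∘_; id)
open import Induction.WellFounded using (module Subrelation)
open import Relation.Binary.Core using (Rel; _⇒_)
open import Relation.Binary.Construct.On as On using ()
open import Relation.Binary.Construct.Union using (_∪_)
open import Relation.Binary.Construct.Closure.Transitive using (Plus; _∼⁺⟨_⟩_) renaming ([_] to [_]⁺)
open import Relation.Binary.Construct.Closure.ReflexiveTransitive using (Star; ε; _◅_; _◅◅_; gmap; _⋆; return)
open import Relation.Binary.Construct.Closure.ReflexiveTransitive.Properties using () renaming (reflexive to Star-reflexive)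
open import Relation.Binary.PropositionalEquality hiding ([_])
open import Relation.Binary.Rewriting using (Confluent; StronglyNormalizing; sn&wcr⇒cr)

-- Abstract rewriting

module _ {ℓ₀ : Level} {A : Set ℓ₀} where

  Diamond : ∀ {ℓ} → Rel A ℓ → Set _
  Diamond R = ∀ {a b c} → R a b → R a c → ∃ λ d → R b d × R c d

  Commute : ∀ {ℓ} → Rel A ℓ → Rel A ℓ → Set _
  Commute R S = ∀ {a b c} → Star R a b → Star S a c → ∃ λ d → Star S b d × Star R c d

  strip⇒commute : ∀ {ℓ} {R S : Rel A ℓ} →
    (∀ {a b c} → R a b → S a c → ∃ λ d → R c d × Star S b d) → Commute R S
  strip⇒commute {R = R} {S = S} strip = commute
    where
    strip* : ∀ {a b c} → R a b → Star S a c → ∃ λ d → R c d × Star S b d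
    strip* r ε = -, r , ε
    strip* r (s ◅ ss) with strip r s
    ... | _ , r′ , ss′ with strip* r′ ss
    ... | d , r″ , ss″ = d , r″ , ss′ ◅◅ ss″

    commute : Commute R S
    commute ε ss = -, ss , ε
    commute (r ◅ rs) ss with strip* r ss
    ... | _ , r′ , ss′ with commute rs ss′
    ... | d , ss″ , rs′ = d , ss″ , r′ ◅ rs′

  diamond⇒confluent : ∀ {ℓ} {R : Rel A ℓ} → Diamond R → Confluent R
  diamond⇒confluent {R = R} dia = strip⇒commute {R = R} {S = R} λ r s →
    let d , bd , cd = dia r s in d , cd , return bd

  confluent-⇔⋆ : ∀ {ℓ₁ ℓ₂} {R : Rel A ℓ₁} {S : Rel A ℓ₂} →
    R ⇒ Star S → S ⇒ Star R → Confluent S → Confluent R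
  confluent-⇔⋆ R⊆S⋆ S⊆R⋆ confS r₁ r₂ =
    let d , s₁ , s₂ = confS ((R⊆S⋆ ⋆) r₁) ((R⊆S⋆ ⋆) r₂) in d , (S⊆R⋆ ⋆) s₁ , (S⊆R⋆ ⋆) s₂

  hindley-rosen : ∀ {ℓ} {R S : Rel A ℓ} →
    Confluent R → Confluent S → Commute R S → Confluent (R ∪ S)
  hindley-rosen {R = R} {S = S} confR confS comm =
    confluent-⇔⋆ (return ∘ [ inj₁ ∘ return , inj₂ ∘ return ])
                 [ gmap id inj₁ , gmap id inj₂ ]
                 (diamond⇒confluent diamond)
    where
    diamond : Diamond (Star R ∪ Star S)
    diamond (inj₁ p) (inj₁ q) = let d , p′ , q′ = confR p q in d , inj₁ p′ , inj₁ q′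
    diamond (inj₂ p) (inj₂ q) = let d , p′ , q′ = confS p q in d , inj₂ p′ , inj₂ q′
    diamond (inj₁ p) (inj₂ q) = let d , q′ , p′ = comm p q in d , inj₂ q′ , inj₁ p′
    diamond (inj₂ p) (inj₁ q) = let d , q′ , p′ = comm q p in d , inj₁ p′ , inj₂ q′

  decreasing⇒sn : ∀ {ℓ} {R : Rel A ℓ} (size : A → ℕ) →
    (∀ {a b} → R a b → size b < size a) → StronglyNormalizing (Plus R)
  decreasing⇒sn {R = R} size dec =
    Subrelation.wellFounded dec⁺ (On.wellFounded size <-wellFounded)
    where
    dec⁺ : ∀ {a b} → Plus R b a → size a < size b
    dec⁺ [ r ]⁺ = dec r
    dec⁺ (_ ∼⁺⟨ r ⟩ r′) = <-trans (dec⁺ r′) (dec⁺ r)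

-- Renaming and substitution

liftR-∘ : ∀ {n m k} {ρ₁ : Ren m k} {ρ₂ : Ren n m} {ρ₃ : Ren n k} →
  ρ₁ ∘ ρ₂ ≗ ρ₃ → liftR ρ₁ ∘ liftR ρ₂ ≗ liftR ρ₃
liftR-∘ h zero = refl
liftR-∘ h (suc i) = cong suc (h i)

mutual
  renT-renT : ∀ {n m k} {ρ₁ : Ren m k} {ρ₂ : Ren n m} {ρ₃ : Ren n k} →
    ρ₁ ∘ ρ₂ ≗ ρ₃ → ∀ t → renT ρ₁ (renT ρ₂ t) ≡ renT ρ₃ t
  renT-renT h (var i) = cong var (h i)
  renT-renT h (lam t) = cong lam (renT-renT (liftR-∘ h) t)
  renT-renT h (brc c) = cong brc (renC-renC h c)

  renL-renL : ∀ {n m k} {ρ₁ : Ren m k} {ρ₂ : Ren n m} {ρ₃ : Ren n k} →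
    ρ₁ ∘ ρ₂ ≗ ρ₃ → ∀ l → renL ρ₁ (renL ρ₂ l) ≡ renL ρ₃ l
  renL-renL h nil = refl
  renL-renL h (cons u l) = cong₂ cons (renT-renT h u) (renL-renL h l)
  renL-renL h (abs c) = cong abs (renC-renC (liftR-∘ h) c)

  renC-renC : ∀ {n m k} {ρ₁ : Ren m k} {ρ₂ : Ren n m} {ρ₃ : Ren n k} →
    ρ₁ ∘ ρ₂ ≗ ρ₃ → ∀ c → renC ρ₁ (renC ρ₂ c) ≡ renC ρ₃ c
  renC-renC h (cut t l) = cong₂ cut (renT-renT h t) (renL-renL h l)

renT-liftR-wk : ∀ {n m} (ρ : Ren n m) t → renT (liftR ρ) (renT suc t) ≡ renT suc (renT ρ t)
renT-liftR-wk ρ t = trans (renT-renT (λ _ → refl) t) (sym (renT-renT (λ _ → refl) t))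

renL-liftR-wk : ∀ {n m} (ρ : Ren n m) l → renL (liftR ρ) (wkL l) ≡ wkL (renL ρ l)
renL-liftR-wk ρ l = trans (renL-renL (λ _ → refl) l) (sym (renL-renL (λ _ → refl) l))

liftS-liftR : ∀ {n m k} {θ₁ : Sub m k} {ρ₂ : Ren n m} {θ₃ : Sub n k} →
  θ₁ ∘ ρ₂ ≗ θ₃ → liftS θ₁ ∘ liftR ρ₂ ≗ liftS θ₃
liftS-liftR h zero = refl
liftS-liftR h (suc i) = cong (renT suc) (h i)

mutual
  subT-renT : ∀ {n m k} {θ₁ : Sub m k} {ρ₂ : Ren n m} {θ₃ : Sub n k} →
    θ₁ ∘ ρ₂ ≗ θ₃ → ∀ t → subT θ₁ (renT ρ₂ t) ≡ subT θ₃ t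
  subT-renT h (var i) = h i
  subT-renT h (lam t) = cong lam (subT-renT (liftS-liftR h) t)
  subT-renT h (brc c) = cong brc (subC-renC h c)

  subL-renL : ∀ {n m k} {θ₁ : Sub m k} {ρ₂ : Ren n m} {θ₃ : Sub n k} →
    θ₁ ∘ ρ₂ ≗ θ₃ → ∀ l → subL θ₁ (renL ρ₂ l) ≡ subL θ₃ l
  subL-renL h nil = refl
  subL-renL h (cons u l) = cong₂ cons (subT-renT h u) (subL-renL h l)
  subL-renL h (abs c) = cong abs (subC-renC (liftS-liftR h) c)

  subC-renC : ∀ {n m k} {θ₁ : Sub m k} {ρ₂ : Ren n m} {θ₃ : Sub n k} →
    θ₁ ∘ ρ₂ ≗ θ₃ → ∀ c → subC θ₁ (renC ρ₂ c) ≡ subC θ₃ c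
  subC-renC h (cut t l) = cong₂ cut (subT-renT h t) (subL-renL h l)

liftR-liftS : ∀ {n m k} {ρ₁ : Ren m k} {θ₂ : Sub n m} {θ₃ : Sub n k} →
  renT ρ₁ ∘ θ₂ ≗ θ₃ → renT (liftR ρ₁) ∘ liftS θ₂ ≗ liftS θ₃
liftR-liftS h zero = refl
liftR-liftS {ρ₁ = ρ₁} {θ₂} h (suc i) = trans (renT-liftR-wk ρ₁ (θ₂ i)) (cong (renT suc) (h i))

mutual
  renT-subT : ∀ {n m k} {ρ₁ : Ren m k} {θ₂ : Sub n m} {θ₃ : Sub n k} →
    renT ρ₁ ∘ θ₂ ≗ θ₃ → ∀ t → renT ρ₁ (subT θ₂ t) ≡ subT θ₃ t
  renT-subT h (var i) = h i
  renT-subT h (lam t) = cong lam (renT-subT (liftR-liftS h) t)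
  renT-subT h (brc c) = cong brc (renC-subC h c)

  renL-subL : ∀ {n m k} {ρ₁ : Ren m k} {θ₂ : Sub n m} {θ₃ : Sub n k} →
    renT ρ₁ ∘ θ₂ ≗ θ₃ → ∀ l → renL ρ₁ (subL θ₂ l) ≡ subL θ₃ l
  renL-subL h nil = refl
  renL-subL h (cons u l) = cong₂ cons (renT-subT h u) (renL-subL h l)
  renL-subL h (abs c) = cong abs (renC-subC (liftR-liftS h) c)

  renC-subC : ∀ {n m k} {ρ₁ : Ren m k} {θ₂ : Sub n m} {θ₃ : Sub n k} →
    renT ρ₁ ∘ θ₂ ≗ θ₃ → ∀ c → renC ρ₁ (subC θ₂ c) ≡ subC θ₃ c
  renC-subC h (cut t l) = cong₂ cut (renT-subT h t) (renL-subL h l)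

subT-liftS-wk : ∀ {n m} (θ : Sub n m) t → subT (liftS θ) (renT suc t) ≡ renT suc (subT θ t)
subT-liftS-wk θ t = trans (subT-renT (λ _ → refl) t) (sym (renT-subT (λ _ → refl) t))

subL-liftS-wk : ∀ {n m} (θ : Sub n m) l → subL (liftS θ) (wkL l) ≡ wkL (subL θ l)
subL-liftS-wk θ l = trans (subL-renL (λ _ → refl) l) (sym (renL-subL (λ _ → refl) l))

liftS-subT : ∀ {n m k} {θ₁ : Sub m k} {θ₂ : Sub n m} {θ₃ : Sub n k} →
  subT θ₁ ∘ θ₂ ≗ θ₃ → subT (liftS θ₁) ∘ liftS θ₂ ≗ liftS θ₃
liftS-subT h zero = refl
liftS-subT {θ₁ = θ₁} {θ₂} h (suc i) = trans (subT-liftS-wk θ₁ (θ₂ i)) (cong (renT suc) (h i))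

mutual
  subT-subT : ∀ {n m k} {θ₁ : Sub m k} {θ₂ : Sub n m} {θ₃ : Sub n k} →
    subT θ₁ ∘ θ₂ ≗ θ₃ → ∀ t → subT θ₁ (subT θ₂ t) ≡ subT θ₃ t
  subT-subT h (var i) = h i
  subT-subT h (lam t) = cong lam (subT-subT (liftS-subT h) t)
  subT-subT h (brc c) = cong brc (subC-subC h c)

  subL-subL : ∀ {n m k} {θ₁ : Sub m k} {θ₂ : Sub n m} {θ₃ : Sub n k} →
    subT θ₁ ∘ θ₂ ≗ θ₃ → ∀ l → subL θ₁ (subL θ₂ l) ≡ subL θ₃ l
  subL-subL h nil = refl
  subL-subL h (cons u l) = cong₂ cons (subT-subT h u) (subL-subL h l)
  subL-subL h (abs c) = cong abs (subC-subC (liftS-subT h) c)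

  subC-subC : ∀ {n m k} {θ₁ : Sub m k} {θ₂ : Sub n m} {θ₃ : Sub n k} →
    subT θ₁ ∘ θ₂ ≗ θ₃ → ∀ c → subC θ₁ (subC θ₂ c) ≡ subC θ₃ c
  subC-subC h (cut t l) = cong₂ cut (subT-subT h t) (subL-subL h l)

liftS-id : ∀ {n} {θ : Sub n n} → θ ≗ var → liftS θ ≗ var
liftS-id h zero = refl
liftS-id h (suc i) = cong (renT suc) (h i)

mutual
  subT-id : ∀ {n} {θ : Sub n n} → θ ≗ var → ∀ t → subT θ t ≡ t
  subT-id h (var i) = h i
  subT-id h (lam t) = cong lam (subT-id (liftS-id h) t)
  subT-id h (brc c) = cong brc (subC-id h c)

  subL-id : ∀ {n} {θ : Sub n n} → θ ≗ var → ∀ l → subL θ l ≡ l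
  subL-id h nil = refl
  subL-id h (cons u l) = cong₂ cons (subT-id h u) (subL-id h l)
  subL-id h (abs c) = cong abs (subC-id (liftS-id h) c)

  subC-id : ∀ {n} {θ : Sub n n} → θ ≗ var → ∀ c → subC θ c ≡ c
  subC-id h (cut t l) = cong₂ cut (subT-id h t) (subL-id h l)

liftR-as-liftS : ∀ {n m} {ρ : Ren n m} {θ : Sub n m} → var ∘ ρ ≗ θ → var ∘ liftR ρ ≗ liftS θ
liftR-as-liftS h zero = refl
liftR-as-liftS h (suc i) = cong (renT suc) (h i)

mutual
  renT-as-subT : ∀ {n m} {ρ : Ren n m} {θ : Sub n m} → var ∘ ρ ≗ θ → ∀ t → renT ρ t ≡ subT θ t
  renT-as-subT h (var i) = h i
  renT-as-subT h (lam t) = cong lam (renT-as-subT (liftR-as-liftS h) t)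
  renT-as-subT h (brc c) = cong brc (renC-as-subC h c)

  renL-as-subL : ∀ {n m} {ρ : Ren n m} {θ : Sub n m} → var ∘ ρ ≗ θ → ∀ l → renL ρ l ≡ subL θ l
  renL-as-subL h nil = refl
  renL-as-subL h (cons u l) = cong₂ cons (renT-as-subT h u) (renL-as-subL h l)
  renL-as-subL h (abs c) = cong abs (renC-as-subC (liftR-as-liftS h) c)

  renC-as-subC : ∀ {n m} {ρ : Ren n m} {θ : Sub n m} → var ∘ ρ ≗ θ → ∀ c → renC ρ c ≡ subC θ c
  renC-as-subC h (cut t l) = cong₂ cut (renT-as-subT h t) (renL-as-subL h l)

renC-[]C : ∀ {n m} (ρ : Ren n m) c t → renC ρ (c [ t ]C) ≡ renC (liftR ρ) c [ renT ρ t ]C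
renC-[]C ρ c t = trans (renC-subC (λ _ → refl) c) (sym (subC-renC sub0-liftR c))
  where
  sub0-liftR : sub0 (renT ρ t) ∘ liftR ρ ≗ renT ρ ∘ sub0 t
  sub0-liftR zero = refl
  sub0-liftR (suc i) = refl

subC-[]C : ∀ {n m} (θ : Sub n m) c t → subC θ (c [ t ]C) ≡ subC (liftS θ) c [ subT θ t ]C
subC-[]C θ c t = trans (subC-subC (λ _ → refl) c) (sym (subC-subC sub0-liftS c))
  where
  sub0-liftS : subT (sub0 (subT θ t)) ∘ liftS θ ≗ subT θ ∘ sub0 t
  sub0-liftS zero = refl
  sub0-liftS (suc i) = trans (subT-renT (λ _ → refl) (θ i)) (subT-id (λ _ → refl) (θ i))

subL-sub0-wkL : ∀ {n} (t : Term n) l → subL (sub0 t) (wkL l) ≡ l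
subL-sub0-wkL t l = trans (subL-renL (λ _ → refl) l) (subL-id (λ _ → refl) l)

renC-liftR-suc-[var0] : ∀ {n} (c : Cmd (suc n)) → renC (liftR suc) c [ var zero ]C ≡ c
renC-liftR-suc-[var0] c = trans (subC-renC sub0-liftR-suc c) (subC-id (λ _ → refl) c)
  where
  sub0-liftR-suc : sub0 (var zero) ∘ liftR suc ≗ var
  sub0-liftR-suc zero = refl
  sub0-liftR-suc (suc i) = refl

infixl 10 _++C_

_++C_ : ∀ {n} → Cmd n → CoTerm n → Cmd n
cut t l ++C E = cut t (l ++L E)

abs-++L : ∀ {n} (c : Cmd (suc n)) E → abs c ++L E ≡ abs (c ++C wkL E)
abs-++L (cut t l) E = refl

renL-++L : ∀ {n m} (ρ : Ren n m) l E → renL ρ (l ++L E) ≡ renL ρ l ++L renL ρ E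
renL-++L ρ nil E = refl
renL-++L ρ (cons u l) E = cong (cons (renT ρ u)) (renL-++L ρ l E)
renL-++L ρ (abs (cut t l)) E = cong (abs ∘ cut (renT (liftR ρ) t)) (begin
  renL (liftR ρ) (l ++L wkL E)                 ≡⟨ renL-++L (liftR ρ) l (wkL E) ⟩
  renL (liftR ρ) l ++L renL (liftR ρ) (wkL E)  ≡⟨ cong (renL (liftR ρ) l ++L_) (renL-liftR-wk ρ E) ⟩
  renL (liftR ρ) l ++L wkL (renL ρ E)          ∎)
  where open ≡-Reasoning

subL-++L : ∀ {n m} (θ : Sub n m) l E → subL θ (l ++L E) ≡ subL θ l ++L subL θ E
subL-++L θ nil E = refl
subL-++L θ (cons u l) E = cong (cons (subT θ u)) (subL-++L θ l E)
subL-++L θ (abs (cut t l)) E = cong (abs ∘ cut (subT (liftS θ) t)) (begin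
  subL (liftS θ) (l ++L wkL E)                 ≡⟨ subL-++L (liftS θ) l (wkL E) ⟩
  subL (liftS θ) l ++L subL (liftS θ) (wkL E)  ≡⟨ cong (subL (liftS θ) l ++L_) (subL-liftS-wk θ E) ⟩
  subL (liftS θ) l ++L wkL (subL θ E)          ∎)
  where open ≡-Reasoning

subC-++C : ∀ {n m} (θ : Sub n m) c E → subC θ (c ++C E) ≡ subC θ c ++C subL θ E
subC-++C θ (cut t l) E = cong (cut (subT θ t)) (subL-++L θ l E)

++L-identityʳ : ∀ {n} (l : CoTerm n) → l ++L nil ≡ l
++L-identityʳ nil = refl
++L-identityʳ (cons u l) = cong (cons u) (++L-identityʳ l)
++L-identityʳ (abs (cut t l)) = cong (abs ∘ cut t) (++L-identityʳ l)

++L-assoc : ∀ {n} (l l′ l″ : CoTerm n) → (l ++L l′) ++L l″ ≡ l ++L (l′ ++L l″)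
++L-assoc nil l′ l″ = refl
++L-assoc (cons u l) l′ l″ = cong (cons u) (++L-assoc l l′ l″)
++L-assoc (abs (cut t l)) l′ l″ =
  cong (abs ∘ cut t) (trans (++L-assoc l (wkL l′) (wkL l″)) (cong (l ++L_) (sym (renL-++L suc l′ l″))))

IsEvalCtx-++L : ∀ {n} {E F : CoTerm n} → IsEvalCtx E → IsEvalCtx F → IsEvalCtx (E ++L F)
IsEvalCtx-++L ec-nil f = f
IsEvalCtx-++L (ec-cons u l) f = ec-cons _ _

IsEvalCtx-renL : ∀ {n m} (ρ : Ren n m) {E} → IsEvalCtx E → IsEvalCtx (renL ρ E)
IsEvalCtx-renL ρ ec-nil = ec-nil
IsEvalCtx-renL ρ (ec-cons u l) = ec-cons _ _

IsEvalCtx-renL⁻ : ∀ {n m} (ρ : Ren n m) E → IsEvalCtx (renL ρ E) → IsEvalCtx E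
IsEvalCtx-renL⁻ ρ nil _ = ec-nil
IsEvalCtx-renL⁻ ρ (cons u l) _ = ec-cons _ _

IsEvalCtx-subL : ∀ {n m} (θ : Sub n m) {E} → IsEvalCtx E → IsEvalCtx (subL θ E)
IsEvalCtx-subL θ ec-nil = ec-nil
IsEvalCtx-subL θ (ec-cons u l) = ec-cons _ _

var-injective : ∀ {n} {i j : Fin n} → var i ≡ var j → i ≡ j
var-injective refl = refl

lam-injective : ∀ {n} {t u : Term (suc n)} → lam t ≡ lam u → t ≡ u
lam-injective refl = refl

brc-injective : ∀ {n} {c d : Cmd n} → brc c ≡ brc d → c ≡ d
brc-injective refl = refl

abs-injective : ∀ {n} {c d : Cmd (suc n)} → abs c ≡ abs d → c ≡ d
abs-injective refl = refl

cons-injective : ∀ {n} {t u : Term n} {l k} → cons t l ≡ cons u k → t ≡ u × l ≡ k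
cons-injective refl = refl , refl

cut-injective : ∀ {n} {t u : Term n} {l k} → cut t l ≡ cut u k → t ≡ u × l ≡ k
cut-injective refl = refl , refl

IsWeakPullback : ∀ {a b c d} → Ren a c → Ren b c → Ren d a → Ren d b → Set
IsWeakPullback {d = d} ρ τ θ κ = ∀ v w → ρ v ≡ τ w → ∃ λ (u : Fin d) → v ≡ θ u × κ u ≡ w

IsWeakPullback-liftR : ∀ {a b c d} {ρ : Ren a c} {τ : Ren b c} {θ : Ren d a} {κ : Ren d b} →
  IsWeakPullback ρ τ θ κ → IsWeakPullback (liftR ρ) (liftR τ) (liftR θ) (liftR κ)
IsWeakPullback-liftR pb zero zero e = zero , refl , refl
IsWeakPullback-liftR pb (suc v) (suc w) e =
  let u , p , q = pb v w (suc-injective e) in suc u , cong suc p , cong suc q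

mutual
  renT-weakPullback : ∀ {a b c d} {ρ : Ren a c} {τ : Ren b c} {θ : Ren d a} {κ : Ren d b} →
    IsWeakPullback ρ τ θ κ → ∀ t u → renT ρ t ≡ renT τ u → ∃ λ s → t ≡ renT θ s × renT κ s ≡ u
  renT-weakPullback pb (var v) (var w) e =
    let x , p , q = pb v w (var-injective e) in var x , cong var p , cong var q
  renT-weakPullback pb (lam t) (lam u) e =
    let s , p , q = renT-weakPullback (IsWeakPullback-liftR pb) t u (lam-injective e)
    in lam s , cong lam p , cong lam q
  renT-weakPullback pb (brc c) (brc d) e =
    let s , p , q = renC-weakPullback pb c d (brc-injective e) in brc s , cong brc p , cong brc q
  renT-weakPullback pb (var _) (lam _) ()
  renT-weakPullback pb (var _) (brc _) ()
  renT-weakPullback pb (lam _) (var _) ()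
  renT-weakPullback pb (lam _) (brc _) ()
  renT-weakPullback pb (brc _) (var _) ()
  renT-weakPullback pb (brc _) (lam _) ()

  renL-weakPullback : ∀ {a b c d} {ρ : Ren a c} {τ : Ren b c} {θ : Ren d a} {κ : Ren d b} →
    IsWeakPullback ρ τ θ κ → ∀ l k → renL ρ l ≡ renL τ k → ∃ λ s → l ≡ renL θ s × renL κ s ≡ k
  renL-weakPullback pb nil nil e = nil , refl , refl
  renL-weakPullback pb (cons t l) (cons u k) e =
    let et , el = cons-injective e
        s , p , q = renT-weakPullback pb t u et
        s′ , p′ , q′ = renL-weakPullback pb l k el
    in cons s s′ , cong₂ cons p p′ , cong₂ cons q q′
  renL-weakPullback pb (abs c) (abs d) e =
    let s , p , q = renC-weakPullback (IsWeakPullback-liftR pb) c d (abs-injective e)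
    in abs s , cong abs p , cong abs q
  renL-weakPullback pb nil (cons _ _) ()
  renL-weakPullback pb nil (abs _) ()
  renL-weakPullback pb (cons _ _) nil ()
  renL-weakPullback pb (cons _ _) (abs _) ()
  renL-weakPullback pb (abs _) nil ()
  renL-weakPullback pb (abs _) (cons _ _) ()

  renC-weakPullback : ∀ {a b c d} {ρ : Ren a c} {τ : Ren b c} {θ : Ren d a} {κ : Ren d b} →
    IsWeakPullback ρ τ θ κ →
    ∀ c c′ → renC ρ c ≡ renC τ c′ → ∃ λ s → c ≡ renC θ s × renC κ s ≡ c′
  renC-weakPullback pb (cut t l) (cut u k) e =
    let et , el = cut-injective e
        s , p , q = renT-weakPullback pb t u et
        s′ , p′ , q′ = renL-weakPullback pb l k el
    in cut s s′ , cong₂ cut p p′ , cong₂ cut q q′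

IsWeakPullback-liftR-suc : ∀ {n m} (ρ : Ren n m) → IsWeakPullback (liftR ρ) suc suc ρ
IsWeakPullback-liftR-suc ρ (suc v) w e = v , refl , suc-injective e

wkL-injective : ∀ {n} {l k : CoTerm n} → wkL l ≡ wkL k → l ≡ k
wkL-injective {l = l} {k} e = let s , p , q = renL-weakPullback pb l k e in trans p q
  where
  pb : IsWeakPullback suc suc id id
  pb v w e = v , refl , suc-injective e

-- Administrative reduction π μ ε

mutual
  sizeT : ∀ {n} → Term n → ℕ
  sizeT (var i) = 1
  sizeT (lam t) = suc (sizeT t)
  sizeT (brc c) = suc (sizeC c)

  sizeL : ∀ {n} → CoTerm n → ℕ
  sizeL nil = 0
  sizeL (cons u l) = suc (sizeT u + sizeL l)
  sizeL (abs c) = suc (sizeC c)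

  sizeC : ∀ {n} → Cmd n → ℕ
  sizeC (cut t l) = sizeT t + sizeL l

mutual
  sizeT-renT : ∀ {n m} (ρ : Ren n m) t → sizeT (renT ρ t) ≡ sizeT t
  sizeT-renT ρ (var i) = refl
  sizeT-renT ρ (lam t) = cong suc (sizeT-renT (liftR ρ) t)
  sizeT-renT ρ (brc c) = cong suc (sizeC-renC ρ c)

  sizeL-renL : ∀ {n m} (ρ : Ren n m) l → sizeL (renL ρ l) ≡ sizeL l
  sizeL-renL ρ nil = refl
  sizeL-renL ρ (cons u l) = cong suc (cong₂ _+_ (sizeT-renT ρ u) (sizeL-renL ρ l))
  sizeL-renL ρ (abs c) = cong suc (sizeC-renC (liftR ρ) c)

  sizeC-renC : ∀ {n m} (ρ : Ren n m) c → sizeC (renC ρ c) ≡ sizeC c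
  sizeC-renC ρ (cut t l) = cong₂ _+_ (sizeT-renT ρ t) (sizeL-renL ρ l)

sizeL-++L : ∀ {n} (l E : CoTerm n) → sizeL (l ++L E) ≡ sizeL l + sizeL E
sizeL-++L nil E = refl
sizeL-++L (cons u l) E = cong suc (begin
  sizeT u + sizeL (l ++L E)      ≡⟨ cong (sizeT u +_) (sizeL-++L l E) ⟩
  sizeT u + (sizeL l + sizeL E)  ≡⟨ +-assoc (sizeT u) (sizeL l) (sizeL E) ⟨
  sizeT u + sizeL l + sizeL E    ∎)
  where open ≡-Reasoning
sizeL-++L (abs (cut t l)) E = cong suc (begin
  sizeT t + sizeL (l ++L wkL E)      ≡⟨ cong (sizeT t +_) (sizeL-++L l (wkL E)) ⟩
  sizeT t + (sizeL l + sizeL (wkL E)) ≡⟨ cong (λ k → sizeT t + (sizeL l + k)) (sizeL-renL suc E) ⟩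
  sizeT t + (sizeL l + sizeL E)      ≡⟨ +-assoc (sizeT t) (sizeL l) (sizeL E) ⟨
  sizeT t + sizeL l + sizeL E        ∎)
  where open ≡-Reasoning

-- μ carries its side condition as an equation, so that it can be matched against a
-- renamed co-term (see ↝L-renL⁻).
infix 4 _↝T_ _↝L_ _↝C_ _↝*T_ _↝*L_ _↝*C_

mutual
  data _↝T_ {n : ℕ} : Term n → Term n → Set where
    ε-↝   : ∀ t → brc (cut t nil) ↝T t
    lam-↝ : ∀ {t t′} → t ↝T t′ → lam t ↝T lam t′
    brc-↝ : ∀ {c c′} → c ↝C c′ → brc c ↝T brc c′

  data _↝L_ {n : ℕ} : CoTerm n → CoTerm n → Set where
    μ-↝     : ∀ l k → k ≡ wkL l → abs (cut (var zero) k) ↝L l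
    cons-↝₁ : ∀ {u u′ l} → u ↝T u′ → cons u l ↝L cons u′ l
    cons-↝₂ : ∀ {u l l′} → l ↝L l′ → cons u l ↝L cons u l′
    abs-↝   : ∀ {c c′} → c ↝C c′ → abs c ↝L abs c′

  data _↝C_ {n : ℕ} : Cmd n → Cmd n → Set where
    π-↝    : ∀ t l E → IsEvalCtx E → cut (brc (cut t l)) E ↝C cut t (l ++L E)
    cut-↝₁ : ∀ {t t′ l} → t ↝T t′ → cut t l ↝C cut t′ l
    cut-↝₂ : ∀ {t l l′} → l ↝L l′ → cut t l ↝C cut t l′

_↝*T_ : ∀ {n} → Rel (Term n) _
_↝*T_ = Star _↝T_

_↝*L_ : ∀ {n} → Rel (CoTerm n) _
_↝*L_ = Star _↝L_

_↝*C_ : ∀ {n} → Rel (Cmd n) _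
_↝*C_ = Star _↝C_

π-↝C : ∀ {n} (c : Cmd n) E → IsEvalCtx E → cut (brc c) E ↝C (c ++C E)
π-↝C (cut t l) E ev = π-↝ t l E ev

cons-↝*₁ : ∀ {n} {u u′ : Term n} {l} → u ↝*T u′ → cons u l ↝*L cons u′ l
cons-↝*₁ {l = l} = gmap (λ x → cons x l) cons-↝₁

cons-↝*₂ : ∀ {n} {u : Term n} {l l′} → l ↝*L l′ → cons u l ↝*L cons u l′
cons-↝*₂ {u = u} = gmap (cons u) cons-↝₂

cut-↝*₁ : ∀ {n} {t t′ : Term n} {l} → t ↝*T t′ → cut t l ↝*C cut t′ l
cut-↝*₁ {l = l} = gmap (λ x → cut x l) cut-↝₁

cut-↝*₂ : ∀ {n} {t : Term n} {l l′} → l ↝*L l′ → cut t l ↝*C cut t l′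
cut-↝*₂ {t = t} = gmap (cut t) cut-↝₂

mutual
  ↝T-subT : ∀ {n m} (θ : Sub n m) {t t′} → t ↝T t′ → subT θ t ↝T subT θ t′
  ↝T-subT θ (ε-↝ t) = ε-↝ (subT θ t)
  ↝T-subT θ (lam-↝ r) = lam-↝ (↝T-subT (liftS θ) r)
  ↝T-subT θ (brc-↝ r) = brc-↝ (↝C-subC θ r)

  ↝L-subL : ∀ {n m} (θ : Sub n m) {l l′} → l ↝L l′ → subL θ l ↝L subL θ l′
  ↝L-subL θ (μ-↝ l _ refl) = μ-↝ (subL θ l) _ (subL-liftS-wk θ l)
  ↝L-subL θ (cons-↝₁ r) = cons-↝₁ (↝T-subT θ r)
  ↝L-subL θ (cons-↝₂ r) = cons-↝₂ (↝L-subL θ r)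
  ↝L-subL θ (abs-↝ r) = abs-↝ (↝C-subC (liftS θ) r)

  ↝C-subC : ∀ {n m} (θ : Sub n m) {c c′} → c ↝C c′ → subC θ c ↝C subC θ c′
  ↝C-subC θ (π-↝ t l E ev) =
    subst ((cut (brc (cut (subT θ t) (subL θ l))) (subL θ E) ↝C_) ∘ cut (subT θ t))
          (sym (subL-++L θ l E)) (π-↝ _ _ _ (IsEvalCtx-subL θ ev))
  ↝C-subC θ (cut-↝₁ r) = cut-↝₁ (↝T-subT θ r)
  ↝C-subC θ (cut-↝₂ r) = cut-↝₂ (↝L-subL θ r)

↝T-renT : ∀ {n m} (ρ : Ren n m) {t t′} → t ↝T t′ → renT ρ t ↝T renT ρ t′
↝T-renT ρ {t} {t′} r =
  subst₂ _↝T_ (sym (renT-as-subT (λ _ → refl) t)) (sym (renT-as-subT (λ _ → refl) t′))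
              (↝T-subT (var ∘ ρ) r)

↝L-renL : ∀ {n m} (ρ : Ren n m) {l l′} → l ↝L l′ → renL ρ l ↝L renL ρ l′
↝L-renL ρ {l} {l′} r =
  subst₂ _↝L_ (sym (renL-as-subL (λ _ → refl) l)) (sym (renL-as-subL (λ _ → refl) l′))
              (↝L-subL (var ∘ ρ) r)

↝*-liftS : ∀ {n m} {θ θ′ : Sub n m} → (∀ i → θ i ↝*T θ′ i) → ∀ i → liftS θ i ↝*T liftS θ′ i
↝*-liftS h zero = ε
↝*-liftS h (suc i) = gmap (renT suc) (↝T-renT suc) (h i)

mutual
  ↝*T-subT : ∀ {n m} {θ θ′ : Sub n m} → (∀ i → θ i ↝*T θ′ i) → ∀ t → subT θ t ↝*T subT θ′ t
  ↝*T-subT h (var i) = h i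
  ↝*T-subT h (lam t) = gmap lam lam-↝ (↝*T-subT (↝*-liftS h) t)
  ↝*T-subT h (brc c) = gmap brc brc-↝ (↝*C-subC h c)

  ↝*L-subL : ∀ {n m} {θ θ′ : Sub n m} → (∀ i → θ i ↝*T θ′ i) → ∀ l → subL θ l ↝*L subL θ′ l
  ↝*L-subL h nil = ε
  ↝*L-subL h (cons u l) = cons-↝*₁ (↝*T-subT h u) ◅◅ cons-↝*₂ (↝*L-subL h l)
  ↝*L-subL h (abs c) = gmap abs abs-↝ (↝*C-subC (↝*-liftS h) c)

  ↝*C-subC : ∀ {n m} {θ θ′ : Sub n m} → (∀ i → θ i ↝*T θ′ i) → ∀ c → subC θ c ↝*C subC θ′ c
  ↝*C-subC h (cut t l) = cut-↝*₁ (↝*T-subT h t) ◅◅ cut-↝*₂ (↝*L-subL h l)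

↝*C-[]C : ∀ {n} (c : Cmd (suc n)) {t t′} → t ↝*T t′ → c [ t ]C ↝*C c [ t′ ]C
↝*C-[]C c r = ↝*C-subC sub0-↝* c
  where
  sub0-↝* : ∀ i → sub0 _ i ↝*T sub0 _ i
  sub0-↝* zero = r
  sub0-↝* (suc i) = ε

mutual
  ↝T-renT⁻ : ∀ {n m} (ρ : Ren n m) t {u} → renT ρ t ↝T u → ∃ λ t′ → u ≡ renT ρ t′ × t ↝T t′
  ↝T-renT⁻ ρ (lam t) (lam-↝ r) with ↝T-renT⁻ (liftR ρ) t r
  ... | t′ , refl , r′ = lam t′ , refl , lam-↝ r′
  ↝T-renT⁻ ρ (brc (cut t nil)) (ε-↝ _) = t , refl , ε-↝ t
  ↝T-renT⁻ ρ (brc c) (brc-↝ r) with ↝C-renC⁻ ρ c r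
  ... | c′ , refl , r′ = brc c′ , refl , brc-↝ r′

  ↝L-renL⁻ : ∀ {n m} (ρ : Ren n m) l {k} → renL ρ l ↝L k → ∃ λ l′ → k ≡ renL ρ l′ × l ↝L l′
  ↝L-renL⁻ ρ (cons u l) (cons-↝₁ r) with ↝T-renT⁻ ρ u r
  ... | u′ , refl , r′ = cons u′ l , refl , cons-↝₁ r′
  ↝L-renL⁻ ρ (cons u l) (cons-↝₂ r) with ↝L-renL⁻ ρ l r
  ... | l′ , refl , r′ = cons u l′ , refl , cons-↝₂ r′
  ↝L-renL⁻ ρ (abs (cut (var zero) k)) (μ-↝ l _ e)
    with renL-weakPullback (IsWeakPullback-liftR-suc ρ) k l e
  ... | l′ , refl , refl = l′ , refl , μ-↝ l′ _ refl
  ↝L-renL⁻ ρ (abs c) (abs-↝ r) with ↝C-renC⁻ (liftR ρ) c r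
  ... | c′ , refl , r′ = abs c′ , refl , abs-↝ r′

  ↝C-renC⁻ : ∀ {n m} (ρ : Ren n m) c {d} → renC ρ c ↝C d → ∃ λ c′ → d ≡ renC ρ c′ × c ↝C c′
  ↝C-renC⁻ ρ (cut (brc (cut t l)) E) (π-↝ _ _ _ ev) =
    cut t (l ++L E) , cong (cut (renT ρ t)) (sym (renL-++L ρ l E)) ,
    π-↝ t l E (IsEvalCtx-renL⁻ ρ E ev)
  ↝C-renC⁻ ρ (cut t l) (cut-↝₁ r) with ↝T-renT⁻ ρ t r
  ... | t′ , refl , r′ = cut t′ l , refl , cut-↝₁ r′
  ↝C-renC⁻ ρ (cut t l) (cut-↝₂ r) with ↝L-renL⁻ ρ l r
  ... | l′ , refl , r′ = cut t l′ , refl , cut-↝₂ r′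

mutual
  ↝L-++L : ∀ {n} {l l′ E : CoTerm n} → l ↝L l′ → IsEvalCtx E → l ++L E ↝L l′ ++L E
  ↝L-++L {E = E} (μ-↝ l _ refl) ev = μ-↝ (l ++L E) _ (sym (renL-++L suc l E))
  ↝L-++L (cons-↝₁ r) ev = cons-↝₁ r
  ↝L-++L (cons-↝₂ r) ev = cons-↝₂ (↝L-++L r ev)
  ↝L-++L (abs-↝ {cut _ _} {cut _ _} r) ev = abs-↝ (↝C-++C r (IsEvalCtx-renL suc ev))

  ↝C-++C : ∀ {n} {c c′ : Cmd n} {E} → c ↝C c′ → IsEvalCtx E → c ++C E ↝C c′ ++C E
  ↝C-++C {E = E} (π-↝ t l F evF) ev =
    subst ((cut (brc (cut t l)) (F ++L E) ↝C_) ∘ cut t) (sym (++L-assoc l F E))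
          (π-↝ t l (F ++L E) (IsEvalCtx-++L evF ev))
  ↝C-++C (cut-↝₁ r) ev = cut-↝₁ r
  ↝C-++C (cut-↝₂ r) ev = cut-↝₂ (↝L-++L r ev)

++L-↝L : ∀ {n} (l : CoTerm n) {E E′} → E ↝L E′ → l ++L E ↝L l ++L E′
++L-↝L nil r = r
++L-↝L (cons u l) r = cons-↝₂ (++L-↝L l r)
++L-↝L (abs (cut t k)) r = abs-↝ (cut-↝₂ (++L-↝L k (↝L-renL suc r)))

IsEvalCtx-↝L : ∀ {n} {E E′ : CoTerm n} → IsEvalCtx E → E ↝L E′ → IsEvalCtx E′
IsEvalCtx-↝L (ec-cons u l) (cons-↝₁ r) = ec-cons _ _
IsEvalCtx-↝L (ec-cons u l) (cons-↝₂ r) = ec-cons _ _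

mutual
  ↝T-decreasing : ∀ {n} {t t′ : Term n} → t ↝T t′ → sizeT t′ < sizeT t
  ↝T-decreasing (ε-↝ t) = s≤s (m≤m+n (sizeT t) 0)
  ↝T-decreasing (lam-↝ r) = s≤s (↝T-decreasing r)
  ↝T-decreasing (brc-↝ r) = s≤s (↝C-decreasing r)

  ↝L-decreasing : ∀ {n} {l l′ : CoTerm n} → l ↝L l′ → sizeL l′ < sizeL l
  ↝L-decreasing (μ-↝ l _ refl) rewrite sizeL-renL suc l = s≤s (n≤1+n (sizeL l))
  ↝L-decreasing (cons-↝₁ {l = l} r) = s≤s (+-monoˡ-< (sizeL l) (↝T-decreasing r))
  ↝L-decreasing (cons-↝₂ {u = u} r) = s≤s (+-monoʳ-< (sizeT u) (↝L-decreasing r))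
  ↝L-decreasing (abs-↝ r) = s≤s (↝C-decreasing r)

  ↝C-decreasing : ∀ {n} {c c′ : Cmd n} → c ↝C c′ → sizeC c′ < sizeC c
  ↝C-decreasing (π-↝ t l E _)
    rewrite sizeL-++L l E | sym (+-assoc (sizeT t) (sizeL l) (sizeL E)) = n<1+n _
  ↝C-decreasing (cut-↝₁ {l = l} r) = +-monoˡ-< (sizeL l) (↝T-decreasing r)
  ↝C-decreasing (cut-↝₂ {t = t} r) = +-monoʳ-< (sizeT t) (↝L-decreasing r)

↝T-wcr-ε : ∀ {n} (t : Term n) {u} → brc (cut t nil) ↝T u → ∃ λ d → t ↝*T d × u ↝*T d
↝T-wcr-ε t (ε-↝ _) = t , ε , ε
↝T-wcr-ε t (brc-↝ (cut-↝₁ {t′ = t′} r)) = t′ , return r , return (ε-↝ t′)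
↝T-wcr-ε .(brc (cut t l)) (brc-↝ (π-↝ t l .nil ev)) =
  brc (cut t l) , ε , Star-reflexive _ (cong (brc ∘ cut t) (++L-identityʳ l))

↝L-wcr-μ : ∀ {n} (l : CoTerm n) {k} → abs (cut (var zero) (wkL l)) ↝L k →
  ∃ λ d → l ↝*L d × k ↝*L d
↝L-wcr-μ l (μ-↝ l′ _ e) = l , ε , Star-reflexive _ (sym (wkL-injective e))
↝L-wcr-μ l (abs-↝ (cut-↝₂ r)) with ↝L-renL⁻ suc l r
... | l′ , refl , r′ = l′ , return r′ , return (μ-↝ l′ _ refl)

↝C-wcr-π : ∀ {n} (t : Term n) l E → IsEvalCtx E → ∀ {c} → cut (brc (cut t l)) E ↝C c →
  ∃ λ d → cut t (l ++L E) ↝*C d × c ↝*C d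
↝C-wcr-π t l E ev (π-↝ _ _ _ _) = -, ε , ε
↝C-wcr-π t .nil E ev (cut-↝₁ (ε-↝ _)) = -, ε , ε
↝C-wcr-π t l E ev (cut-↝₁ (brc-↝ (cut-↝₁ {t′ = t′} r))) =
  cut t′ (l ++L E) , return (cut-↝₁ r) , return (π-↝ t′ l E ev)
↝C-wcr-π t l E ev (cut-↝₁ (brc-↝ (cut-↝₂ {l′ = l′} r))) =
  cut t (l′ ++L E) , return (cut-↝₂ (↝L-++L r ev)) , return (π-↝ t l′ E ev)
↝C-wcr-π .(brc (cut t₀ l₀)) .E₀ E ev (cut-↝₁ (brc-↝ (π-↝ t₀ l₀ E₀ ev₀))) =
  cut t₀ (l₀ ++L (E₀ ++L E)) ,
  return (π-↝ t₀ l₀ (E₀ ++L E) (IsEvalCtx-++L ev₀ ev)) ,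
  π-↝ t₀ (l₀ ++L E₀) E ev ◅ Star-reflexive _ (cong (cut t₀) (++L-assoc l₀ E₀ E))
↝C-wcr-π t l E ev (cut-↝₂ {l′ = E′} r) =
  cut t (l ++L E′) , return (cut-↝₂ (++L-↝L l r)) , return (π-↝ t l E′ (IsEvalCtx-↝L ev r))

mutual
  ↝T-wcr : ∀ {n} {t u v : Term n} → t ↝T u → t ↝T v → ∃ λ d → u ↝*T d × v ↝*T d
  ↝T-wcr (ε-↝ t) r = ↝T-wcr-ε t r
  ↝T-wcr r (ε-↝ t) = map₂ swap (↝T-wcr-ε t r)
  ↝T-wcr (lam-↝ r) (lam-↝ r′) =
    let d , s , s′ = ↝T-wcr r r′ in lam d , gmap lam lam-↝ s , gmap lam lam-↝ s′
  ↝T-wcr (brc-↝ r) (brc-↝ r′) =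
    let d , s , s′ = ↝C-wcr r r′ in brc d , gmap brc brc-↝ s , gmap brc brc-↝ s′

  ↝L-wcr : ∀ {n} {l k k′ : CoTerm n} → l ↝L k → l ↝L k′ → ∃ λ d → k ↝*L d × k′ ↝*L d
  ↝L-wcr (μ-↝ l _ refl) r = ↝L-wcr-μ l r
  ↝L-wcr r (μ-↝ l _ refl) = map₂ swap (↝L-wcr-μ l r)
  ↝L-wcr (cons-↝₁ {l = l} r) (cons-↝₁ r′) =
    let d , s , s′ = ↝T-wcr r r′ in cons d l , cons-↝*₁ s , cons-↝*₁ s′
  ↝L-wcr (cons-↝₁ {u′ = u′} r) (cons-↝₂ {l′ = l′} r′) =
    cons u′ l′ , return (cons-↝₂ r′) , return (cons-↝₁ r)
  ↝L-wcr (cons-↝₂ {l′ = l′} r) (cons-↝₁ {u′ = u′} r′) =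
    cons u′ l′ , return (cons-↝₁ r′) , return (cons-↝₂ r)
  ↝L-wcr (cons-↝₂ {u = u} r) (cons-↝₂ r′) =
    let d , s , s′ = ↝L-wcr r r′ in cons u d , cons-↝*₂ s , cons-↝*₂ s′
  ↝L-wcr (abs-↝ r) (abs-↝ r′) =
    let d , s , s′ = ↝C-wcr r r′ in abs d , gmap abs abs-↝ s , gmap abs abs-↝ s′

  ↝C-wcr : ∀ {n} {c d d′ : Cmd n} → c ↝C d → c ↝C d′ → ∃ λ e → d ↝*C e × d′ ↝*C e
  ↝C-wcr (π-↝ t l E ev) r = ↝C-wcr-π t l E ev r
  ↝C-wcr r (π-↝ t l E ev) = map₂ swap (↝C-wcr-π t l E ev r)
  ↝C-wcr (cut-↝₁ {l = l} r) (cut-↝₁ r′) =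
    let d , s , s′ = ↝T-wcr r r′ in cut d l , cut-↝*₁ s , cut-↝*₁ s′
  ↝C-wcr (cut-↝₁ {t′ = t′} r) (cut-↝₂ {l′ = l′} r′) =
    cut t′ l′ , return (cut-↝₂ r′) , return (cut-↝₁ r)
  ↝C-wcr (cut-↝₂ {l′ = l′} r) (cut-↝₁ {t′ = t′} r′) =
    cut t′ l′ , return (cut-↝₁ r′) , return (cut-↝₂ r)
  ↝C-wcr (cut-↝₂ {t = t} r) (cut-↝₂ r′) =
    let d , s , s′ = ↝L-wcr r r′ in cut t d , cut-↝*₂ s , cut-↝*₂ s′

↝T-confluent : ∀ {n} → Confluent (_↝T_ {n})
↝T-confluent = sn&wcr⇒cr (decreasing⇒sn sizeT ↝T-decreasing) ↝T-wcr

-- Parallel β σ reduction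

infix 4 _⇒T_ _⇒L_ _⇒C_

mutual
  data _⇒T_ {n : ℕ} : Term n → Term n → Set where
    var-⇒ : ∀ i → var i ⇒T var i
    lam-⇒ : ∀ {t t′} → t ⇒T t′ → lam t ⇒T lam t′
    brc-⇒ : ∀ {c c′} → c ⇒C c′ → brc c ⇒T brc c′

  data _⇒L_ {n : ℕ} : CoTerm n → CoTerm n → Set where
    nil-⇒  : nil ⇒L nil
    cons-⇒ : ∀ {u u′ l l′} → u ⇒T u′ → l ⇒L l′ → cons u l ⇒L cons u′ l′
    abs-⇒  : ∀ {c c′} → c ⇒C c′ → abs c ⇒L abs c′

  data _⇒C_ {n : ℕ} : Cmd n → Cmd n → Set where
    cut-⇒ : ∀ {t t′ l l′} → t ⇒T t′ → l ⇒L l′ → cut t l ⇒C cut t′ l′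
    β-⇒   : ∀ {t t′ u u′ l l′} → t ⇒T t′ → u ⇒T u′ → l ⇒L l′ →
            cut (lam t) (cons u l) ⇒C cut u′ (abs (cut t′ (wkL l′)))
    σ-⇒   : ∀ {t t′ c c′} → t ⇒T t′ → c ⇒C c′ → cut t (abs c) ⇒C c′ [ t′ ]C

mutual
  ⇒T-refl : ∀ {n} (t : Term n) → t ⇒T t
  ⇒T-refl (var i) = var-⇒ i
  ⇒T-refl (lam t) = lam-⇒ (⇒T-refl t)
  ⇒T-refl (brc c) = brc-⇒ (⇒C-refl c)

  ⇒L-refl : ∀ {n} (l : CoTerm n) → l ⇒L l
  ⇒L-refl nil = nil-⇒
  ⇒L-refl (cons u l) = cons-⇒ (⇒T-refl u) (⇒L-refl l)
  ⇒L-refl (abs c) = abs-⇒ (⇒C-refl c)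

  ⇒C-refl : ∀ {n} (c : Cmd n) → c ⇒C c
  ⇒C-refl (cut t l) = cut-⇒ (⇒T-refl t) (⇒L-refl l)

mutual
  ⇒T-renT : ∀ {n m} (ρ : Ren n m) {t t′} → t ⇒T t′ → renT ρ t ⇒T renT ρ t′
  ⇒T-renT ρ (var-⇒ i) = var-⇒ (ρ i)
  ⇒T-renT ρ (lam-⇒ p) = lam-⇒ (⇒T-renT (liftR ρ) p)
  ⇒T-renT ρ (brc-⇒ p) = brc-⇒ (⇒C-renC ρ p)

  ⇒L-renL : ∀ {n m} (ρ : Ren n m) {l l′} → l ⇒L l′ → renL ρ l ⇒L renL ρ l′
  ⇒L-renL ρ nil-⇒ = nil-⇒
  ⇒L-renL ρ (cons-⇒ p q) = cons-⇒ (⇒T-renT ρ p) (⇒L-renL ρ q)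
  ⇒L-renL ρ (abs-⇒ p) = abs-⇒ (⇒C-renC (liftR ρ) p)

  ⇒C-renC : ∀ {n m} (ρ : Ren n m) {c c′} → c ⇒C c′ → renC ρ c ⇒C renC ρ c′
  ⇒C-renC ρ (cut-⇒ p q) = cut-⇒ (⇒T-renT ρ p) (⇒L-renL ρ q)
  ⇒C-renC ρ (β-⇒ {l′ = l′} p q r) =
    subst (λ k → _ ⇒C cut _ (abs (cut _ k))) (sym (renL-liftR-wk ρ l′))
          (β-⇒ (⇒T-renT (liftR ρ) p) (⇒T-renT ρ q) (⇒L-renL ρ r))
  ⇒C-renC ρ (σ-⇒ {t′ = t′} {c′ = c′} p q) =
    subst (_ ⇒C_) (sym (renC-[]C ρ c′ t′)) (σ-⇒ (⇒T-renT ρ p) (⇒C-renC (liftR ρ) q))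

⇒-liftS : ∀ {n m} {θ θ′ : Sub n m} → (∀ i → θ i ⇒T θ′ i) → ∀ i → liftS θ i ⇒T liftS θ′ i
⇒-liftS h zero = var-⇒ zero
⇒-liftS h (suc i) = ⇒T-renT suc (h i)

mutual
  ⇒T-subT : ∀ {n m} {θ θ′ : Sub n m} → (∀ i → θ i ⇒T θ′ i) →
    ∀ {t t′} → t ⇒T t′ → subT θ t ⇒T subT θ′ t′
  ⇒T-subT h (var-⇒ i) = h i
  ⇒T-subT h (lam-⇒ p) = lam-⇒ (⇒T-subT (⇒-liftS h) p)
  ⇒T-subT h (brc-⇒ p) = brc-⇒ (⇒C-subC h p)

  ⇒L-subL : ∀ {n m} {θ θ′ : Sub n m} → (∀ i → θ i ⇒T θ′ i) →
    ∀ {l l′} → l ⇒L l′ → subL θ l ⇒L subL θ′ l′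
  ⇒L-subL h nil-⇒ = nil-⇒
  ⇒L-subL h (cons-⇒ p q) = cons-⇒ (⇒T-subT h p) (⇒L-subL h q)
  ⇒L-subL h (abs-⇒ p) = abs-⇒ (⇒C-subC (⇒-liftS h) p)

  ⇒C-subC : ∀ {n m} {θ θ′ : Sub n m} → (∀ i → θ i ⇒T θ′ i) →
    ∀ {c c′} → c ⇒C c′ → subC θ c ⇒C subC θ′ c′
  ⇒C-subC h (cut-⇒ p q) = cut-⇒ (⇒T-subT h p) (⇒L-subL h q)
  ⇒C-subC {θ′ = θ′} h (β-⇒ {l′ = l′} p q r) =
    subst (λ k → _ ⇒C cut _ (abs (cut _ k))) (sym (subL-liftS-wk θ′ l′))
          (β-⇒ (⇒T-subT (⇒-liftS h) p) (⇒T-subT h q) (⇒L-subL h r))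
  ⇒C-subC {θ′ = θ′} h (σ-⇒ {t′ = t′} {c′ = c′} p q) =
    subst (_ ⇒C_) (sym (subC-[]C θ′ c′ t′)) (σ-⇒ (⇒T-subT h p) (⇒C-subC (⇒-liftS h) q))

⇒C-[]C : ∀ {n} {c c′ : Cmd (suc n)} {t t′} → c ⇒C c′ → t ⇒T t′ → c [ t ]C ⇒C c′ [ t′ ]C
⇒C-[]C p q = ⇒C-subC sub0-⇒ p
  where
  sub0-⇒ : ∀ i → sub0 _ i ⇒T sub0 _ i
  sub0-⇒ zero = q
  sub0-⇒ (suc i) = var-⇒ i

mutual
  ⇒T-renT⁻ : ∀ {n m} (ρ : Ren n m) t {u} → renT ρ t ⇒T u → ∃ λ t′ → u ≡ renT ρ t′ × t ⇒T t′
  ⇒T-renT⁻ ρ (var i) (var-⇒ _) = var i , refl , var-⇒ i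
  ⇒T-renT⁻ ρ (lam t) (lam-⇒ p) with ⇒T-renT⁻ (liftR ρ) t p
  ... | t′ , refl , p′ = lam t′ , refl , lam-⇒ p′
  ⇒T-renT⁻ ρ (brc c) (brc-⇒ p) with ⇒C-renC⁻ ρ c p
  ... | c′ , refl , p′ = brc c′ , refl , brc-⇒ p′

  ⇒L-renL⁻ : ∀ {n m} (ρ : Ren n m) l {k} → renL ρ l ⇒L k → ∃ λ l′ → k ≡ renL ρ l′ × l ⇒L l′
  ⇒L-renL⁻ ρ nil nil-⇒ = nil , refl , nil-⇒
  ⇒L-renL⁻ ρ (cons u l) (cons-⇒ p q) with ⇒T-renT⁻ ρ u p | ⇒L-renL⁻ ρ l q
  ... | u′ , refl , p′ | l′ , refl , q′ = cons u′ l′ , refl , cons-⇒ p′ q′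
  ⇒L-renL⁻ ρ (abs c) (abs-⇒ p) with ⇒C-renC⁻ (liftR ρ) c p
  ... | c′ , refl , p′ = abs c′ , refl , abs-⇒ p′

  ⇒C-renC⁻ : ∀ {n m} (ρ : Ren n m) c {d} → renC ρ c ⇒C d → ∃ λ c′ → d ≡ renC ρ c′ × c ⇒C c′
  ⇒C-renC⁻ ρ (cut (lam t) (cons u l)) (β-⇒ p q r)
    with ⇒T-renT⁻ (liftR ρ) t p | ⇒T-renT⁻ ρ u q | ⇒L-renL⁻ ρ l r
  ... | t′ , refl , p′ | u′ , refl , q′ | l′ , refl , r′ =
    cut u′ (abs (cut t′ (wkL l′))) ,
    cong (cut _ ∘ abs ∘ cut _) (sym (renL-liftR-wk ρ l′)) ,
    β-⇒ p′ q′ r′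
  ⇒C-renC⁻ ρ (cut t (abs c)) (σ-⇒ p q) with ⇒T-renT⁻ ρ t p | ⇒C-renC⁻ (liftR ρ) c q
  ... | t′ , refl , p′ | c′ , refl , q′ = c′ [ t′ ]C , sym (renC-[]C ρ c′ t′) , σ-⇒ p′ q′
  ⇒C-renC⁻ ρ (cut t l) (cut-⇒ p q) with ⇒T-renT⁻ ρ t p | ⇒L-renL⁻ ρ l q
  ... | t′ , refl , p′ | l′ , refl , q′ = cut t′ l′ , refl , cut-⇒ p′ q′

[]C-++C-wkL : ∀ {n} (c : Cmd (suc n)) t E → (c ++C wkL E) [ t ]C ≡ c [ t ]C ++C E
[]C-++C-wkL c t E = trans (subC-++C (sub0 t) c (wkL E)) (cong (c [ t ]C ++C_) (subL-sub0-wkL t E))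

mutual
  ⇒L-++L : ∀ {n} {l l′ E E′ : CoTerm n} → l ⇒L l′ → E ⇒L E′ → l ++L E ⇒L l′ ++L E′
  ⇒L-++L nil-⇒ h = h
  ⇒L-++L (cons-⇒ p q) h = cons-⇒ p (⇒L-++L q h)
  ⇒L-++L {E = E} {E′} (abs-⇒ {c} {c′} p) h =
    subst₂ _⇒L_ (sym (abs-++L c E)) (sym (abs-++L c′ E′)) (abs-⇒ (⇒C-++C p (⇒L-renL suc h)))

  ⇒C-++C : ∀ {n} {c c′ : Cmd n} {E E′} → c ⇒C c′ → E ⇒L E′ → c ++C E ⇒C c′ ++C E′
  ⇒C-++C (cut-⇒ p q) h = cut-⇒ p (⇒L-++L q h)
  ⇒C-++C {E′ = E′} (β-⇒ {l′ = l′} p q r) h =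
    subst (λ k → _ ⇒C cut _ (abs (cut _ k))) (renL-++L suc l′ E′) (β-⇒ p q (⇒L-++L r h))
  ⇒C-++C {E′ = E′} (σ-⇒ {t′ = t′} {c = cut _ _} {c′} p q) h =
    subst (_ ⇒C_) ([]C-++C-wkL c′ t′ E′) (σ-⇒ p (⇒C-++C q (⇒L-renL suc h)))

IsEvalCtx-⇒L : ∀ {n} {E E′ : CoTerm n} → IsEvalCtx E → E ⇒L E′ → IsEvalCtx E′
IsEvalCtx-⇒L ec-nil nil-⇒ = ec-nil
IsEvalCtx-⇒L (ec-cons u l) (cons-⇒ p q) = ec-cons _ _

mutual
  devT : ∀ {n} → Term n → Term n
  devT (var i) = var i
  devT (lam t) = lam (devT t)
  devT (brc c) = brc (devC c)

  devL : ∀ {n} → CoTerm n → CoTerm n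
  devL nil = nil
  devL (cons u l) = cons (devT u) (devL l)
  devL (abs c) = abs (devC c)

  devC : ∀ {n} → Cmd n → Cmd n
  devC (cut t (abs c)) = devC c [ devT t ]C
  devC (cut (lam t) (cons u l)) = cut (devT u) (abs (cut (devT t) (wkL (devL l))))
  devC (cut t nil) = cut (devT t) nil
  devC (cut (var i) (cons u l)) = cut (var i) (cons (devT u) (devL l))
  devC (cut (brc c) (cons u l)) = cut (brc (devC c)) (cons (devT u) (devL l))

mutual
  ⇒T-triangle : ∀ {n} {t t′ : Term n} → t ⇒T t′ → t′ ⇒T devT t
  ⇒T-triangle (var-⇒ i) = var-⇒ i
  ⇒T-triangle (lam-⇒ p) = lam-⇒ (⇒T-triangle p)
  ⇒T-triangle (brc-⇒ p) = brc-⇒ (⇒C-triangle p)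

  ⇒L-triangle : ∀ {n} {l l′ : CoTerm n} → l ⇒L l′ → l′ ⇒L devL l
  ⇒L-triangle nil-⇒ = nil-⇒
  ⇒L-triangle (cons-⇒ p q) = cons-⇒ (⇒T-triangle p) (⇒L-triangle q)
  ⇒L-triangle (abs-⇒ p) = abs-⇒ (⇒C-triangle p)

  ⇒C-triangle : ∀ {n} {c c′ : Cmd n} → c ⇒C c′ → c′ ⇒C devC c
  ⇒C-triangle (cut-⇒ p (abs-⇒ q)) = σ-⇒ (⇒T-triangle p) (⇒C-triangle q)
  ⇒C-triangle (cut-⇒ (lam-⇒ p) (cons-⇒ q r)) = β-⇒ (⇒T-triangle p) (⇒T-triangle q) (⇒L-triangle r)
  ⇒C-triangle (cut-⇒ p nil-⇒) = cut-⇒ (⇒T-triangle p) nil-⇒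
  ⇒C-triangle (cut-⇒ (var-⇒ i) (cons-⇒ q r)) =
    cut-⇒ (var-⇒ i) (cons-⇒ (⇒T-triangle q) (⇒L-triangle r))
  ⇒C-triangle (cut-⇒ (brc-⇒ p) (cons-⇒ q r)) =
    cut-⇒ (brc-⇒ (⇒C-triangle p)) (cons-⇒ (⇒T-triangle q) (⇒L-triangle r))
  ⇒C-triangle (β-⇒ p q r) =
    cut-⇒ (⇒T-triangle q) (abs-⇒ (cut-⇒ (⇒T-triangle p) (⇒L-renL suc (⇒L-triangle r))))
  ⇒C-triangle (σ-⇒ p q) = ⇒C-[]C (⇒C-triangle q) (⇒T-triangle p)

⇒T-confluent : ∀ {n} → Confluent (_⇒T_ {n})
⇒T-confluent = diamond⇒confluent λ {t} p q → devT t , ⇒T-triangle p , ⇒T-triangle q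

-- Commutation of ⇒ and ↝

μ-redex-⇒C⁻ : ∀ {n} (l : CoTerm n) {e} → cut (var zero) (wkL l) ⇒C e →
  (∃ λ l′ → l ⇒L l′ × e ≡ cut (var zero) (wkL l′)) ⊎
  (∃₂ λ c c′ → l ≡ abs c × c ⇒C c′ × e ≡ c′)
μ-redex-⇒C⁻ (abs c) (σ-⇒ (var-⇒ _) p) with ⇒C-renC⁻ (liftR suc) c p
... | c′ , refl , p′ = inj₂ (c , c′ , refl , p′ , renC-liftR-suc-[var0] c′)
μ-redex-⇒C⁻ l (cut-⇒ (var-⇒ _) p) with ⇒L-renL⁻ suc l p
... | l′ , refl , p′ = inj₁ (l′ , p′ , refl)

mutual
  ⇒T-↝T-strip : ∀ {n} {t u v : Term n} → t ⇒T u → t ↝T v → ∃ λ d → v ⇒T d × u ↝*T d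
  ⇒T-↝T-strip (brc-⇒ (cut-⇒ {t′ = t′} p nil-⇒)) (ε-↝ t) = t′ , p , return (ε-↝ t′)
  ⇒T-↝T-strip (lam-⇒ p) (lam-↝ r) =
    let d , q , s = ⇒T-↝T-strip p r in lam d , lam-⇒ q , gmap lam lam-↝ s
  ⇒T-↝T-strip (brc-⇒ p) (brc-↝ r) =
    let d , q , s = ⇒C-↝C-strip p r in brc d , brc-⇒ q , gmap brc brc-↝ s

  ⇒L-↝L-strip : ∀ {n} {l k k′ : CoTerm n} → l ⇒L k → l ↝L k′ → ∃ λ d → k′ ⇒L d × k ↝*L d
  ⇒L-↝L-strip (abs-⇒ p) (μ-↝ l _ refl) with μ-redex-⇒C⁻ l p
  ... | inj₁ (l′ , q , refl) = l′ , q , return (μ-↝ l′ _ refl)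
  ... | inj₂ (c , c′ , refl , q , refl) = abs c′ , abs-⇒ q , ε
  ⇒L-↝L-strip (cons-⇒ {l′ = l′} p q) (cons-↝₁ r) =
    let d , p′ , s = ⇒T-↝T-strip p r in cons d l′ , cons-⇒ p′ q , cons-↝*₁ s
  ⇒L-↝L-strip (cons-⇒ {u′ = u′} p q) (cons-↝₂ r) =
    let d , q′ , s = ⇒L-↝L-strip q r in cons u′ d , cons-⇒ p q′ , cons-↝*₂ s
  ⇒L-↝L-strip (abs-⇒ p) (abs-↝ r) =
    let d , q , s = ⇒C-↝C-strip p r in abs d , abs-⇒ q , gmap abs abs-↝ s

  ⇒C-↝C-strip : ∀ {n} {c d d′ : Cmd n} → c ⇒C d → c ↝C d′ → ∃ λ e → d′ ⇒C e × d ↝*C e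
  ⇒C-↝C-strip (cut-⇒ (brc-⇒ p) h) (π-↝ _ _ _ ev) =
    -, ⇒C-++C p h , return (π-↝C _ _ (IsEvalCtx-⇒L ev h))
  ⇒C-↝C-strip (cut-⇒ {l′ = l′} p q) (cut-↝₁ r) =
    let d , p′ , s = ⇒T-↝T-strip p r in cut d l′ , cut-⇒ p′ q , cut-↝*₁ s
  ⇒C-↝C-strip (cut-⇒ {t′ = t′} p q) (cut-↝₂ r) =
    let d , q′ , s = ⇒L-↝L-strip q r in cut t′ d , cut-⇒ p q′ , cut-↝*₂ s
  ⇒C-↝C-strip (β-⇒ {u′ = u′} {l′ = l′} p q r) (cut-↝₁ (lam-↝ r′)) =
    let d , p′ , s = ⇒T-↝T-strip p r′
    in cut u′ (abs (cut d (wkL l′))) , β-⇒ p′ q r ,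
       gmap (λ x → cut u′ (abs (cut x (wkL l′)))) (cut-↝₂ ∘ abs-↝ ∘ cut-↝₁) s
  ⇒C-↝C-strip (β-⇒ {t′ = t′} {l′ = l′} p q r) (cut-↝₂ (cons-↝₁ r′)) =
    let d , q′ , s = ⇒T-↝T-strip q r′
    in cut d (abs (cut t′ (wkL l′))) , β-⇒ p q′ r , cut-↝*₁ s
  ⇒C-↝C-strip (β-⇒ {t′ = t′} {u′ = u′} p q r) (cut-↝₂ (cons-↝₂ r′)) =
    let d , r″ , s = ⇒L-↝L-strip r r′
    in cut u′ (abs (cut t′ (wkL d))) , β-⇒ p q r″ ,
       gmap (λ x → cut u′ (abs (cut t′ (wkL x)))) (cut-↝₂ ∘ abs-↝ ∘ cut-↝₂ ∘ ↝L-renL suc) s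
  ⇒C-↝C-strip (σ-⇒ {c′ = c′} p q) (cut-↝₁ r) =
    let d , p′ , s = ⇒T-↝T-strip p r in c′ [ d ]C , σ-⇒ p′ q , ↝*C-[]C c′ s
  ⇒C-↝C-strip (σ-⇒ {t′ = t′} p q) (cut-↝₂ (abs-↝ r)) =
    let d , q′ , s = ⇒C-↝C-strip q r
    in d [ t′ ]C , σ-⇒ p q′ , gmap (_[ t′ ]C) (↝C-subC (sub0 t′)) s
  ⇒C-↝C-strip (σ-⇒ {t′ = t′} p q) (cut-↝₂ (μ-↝ l _ refl)) with μ-redex-⇒C⁻ l q
  ... | inj₁ (l′ , q′ , refl) =
    cut t′ l′ , cut-⇒ p q′ , Star-reflexive _ (cong (cut t′) (subL-sub0-wkL t′ l′))
  ... | inj₂ (c , c′ , refl , q′ , refl) = c′ [ t′ ]C , σ-⇒ p q′ , ε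

⇒T-↝T-commute : ∀ {n} → Commute (_⇒T_ {n}) _↝T_
⇒T-↝T-commute = strip⇒commute ⇒T-↝T-strip

mutual
  →T-split : ∀ {n} {t u : Term n} → t →T u → (t ⇒T u) ⊎ (t ↝T u)
  →T-split (ε t) = inj₂ (ε-↝ t)
  →T-split (lamξ r) = ⊎-map lam-⇒ lam-↝ (→T-split r)
  →T-split (brcξ r) = ⊎-map brc-⇒ brc-↝ (→C-split r)

  →L-split : ∀ {n} {l k : CoTerm n} → l →L k → (l ⇒L k) ⊎ (l ↝L k)
  →L-split (μ l) = inj₂ (μ-↝ l _ refl)
  →L-split (consξ₁ {l = l} r) = ⊎-map (λ p → cons-⇒ p (⇒L-refl l)) cons-↝₁ (→T-split r)
  →L-split (consξ₂ {u = u} r) = ⊎-map (cons-⇒ (⇒T-refl u)) cons-↝₂ (→L-split r)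
  →L-split (absξ r) = ⊎-map abs-⇒ abs-↝ (→C-split r)

  →C-split : ∀ {n} {c d : Cmd n} → c →C d → (c ⇒C d) ⊎ (c ↝C d)
  →C-split (β t u l) = inj₁ (β-⇒ (⇒T-refl t) (⇒T-refl u) (⇒L-refl l))
  →C-split (π t l E ev) = inj₂ (π-↝ t l E ev)
  →C-split (σ t c) = inj₁ (σ-⇒ (⇒T-refl t) (⇒C-refl c))
  →C-split (cutξ₁ {l = l} r) = ⊎-map (λ p → cut-⇒ p (⇒L-refl l)) cut-↝₁ (→T-split r)
  →C-split (cutξ₂ {t = t} r) = ⊎-map (cut-⇒ (⇒T-refl t)) cut-↝₂ (→L-split r)

mutual
  ↝T-sound : ∀ {n} {t u : Term n} → t ↝T u → t →T u
  ↝T-sound (ε-↝ t) = ε t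
  ↝T-sound (lam-↝ r) = lamξ (↝T-sound r)
  ↝T-sound (brc-↝ r) = brcξ (↝C-sound r)

  ↝L-sound : ∀ {n} {l k : CoTerm n} → l ↝L k → l →L k
  ↝L-sound (μ-↝ l _ refl) = μ l
  ↝L-sound (cons-↝₁ r) = consξ₁ (↝T-sound r)
  ↝L-sound (cons-↝₂ r) = consξ₂ (↝L-sound r)
  ↝L-sound (abs-↝ r) = absξ (↝C-sound r)

  ↝C-sound : ∀ {n} {c d : Cmd n} → c ↝C d → c →C d
  ↝C-sound (π-↝ t l E ev) = π t l E ev
  ↝C-sound (cut-↝₁ r) = cutξ₁ (↝T-sound r)
  ↝C-sound (cut-↝₂ r) = cutξ₂ (↝L-sound r)

_→*L_ : ∀ {n} → Rel (CoTerm n) _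
_→*L_ = Star _→L_

_→*C_ : ∀ {n} → Rel (Cmd n) _
_→*C_ = Star _→C_

cons-→* : ∀ {n} {u u′ : Term n} {l l′} → u →*T u′ → l →*L l′ → cons u l →*L cons u′ l′
cons-→* {u′ = u′} {l = l} p q = gmap (λ x → cons x l) consξ₁ p ◅◅ gmap (cons u′) consξ₂ q

cut-→* : ∀ {n} {t t′ : Term n} {l l′} → t →*T t′ → l →*L l′ → cut t l →*C cut t′ l′
cut-→* {t′ = t′} {l = l} p q = gmap (λ x → cut x l) cutξ₁ p ◅◅ gmap (cut t′) cutξ₂ q

mutual
  ⇒T-sound : ∀ {n} {t u : Term n} → t ⇒T u → t →*T u
  ⇒T-sound (var-⇒ i) = ε
  ⇒T-sound (lam-⇒ p) = gmap lam lamξ (⇒T-sound p)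
  ⇒T-sound (brc-⇒ p) = gmap brc brcξ (⇒C-sound p)

  ⇒L-sound : ∀ {n} {l k : CoTerm n} → l ⇒L k → l →*L k
  ⇒L-sound nil-⇒ = ε
  ⇒L-sound (cons-⇒ p q) = cons-→* (⇒T-sound p) (⇒L-sound q)
  ⇒L-sound (abs-⇒ p) = gmap abs absξ (⇒C-sound p)

  ⇒C-sound : ∀ {n} {c d : Cmd n} → c ⇒C d → c →*C d
  ⇒C-sound (cut-⇒ p q) = cut-→* (⇒T-sound p) (⇒L-sound q)
  ⇒C-sound (β-⇒ {t′ = t′} {u′ = u′} {l′ = l′} p q r) =
    cut-→* (gmap lam lamξ (⇒T-sound p)) (cons-→* (⇒T-sound q) (⇒L-sound r)) ◅◅
    return (β t′ u′ l′)
  ⇒C-sound (σ-⇒ {t′ = t′} {c′ = c′} p q) =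
    cut-→* (⇒T-sound p) (gmap abs absξ (⇒C-sound q)) ◅◅ return (σ t′ c′)

theorem3p8 : ∀ {n : ℕ} (t t₁ t₂ : Term n) → t →*T t₁ → t →*T t₂
             → Σ (Term n) (λ t₃ → (t₁ →*T t₃) × (t₂ →*T t₃))
theorem3p8 _ _ _ =
  confluent-⇔⋆ (return ∘ →T-split) [ ⇒T-sound , return ∘ ↝T-sound ]
    (hindley-rosen ⇒T-confluent ↝T-confluent ⇒T-↝T-commute)
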